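{- Let $(M,<)$ be an ordered loopless matroid. Then the set of nbc bases of $M$ is an order ideal (down-closed subset) of the poset $\mathrm{Int}_<(M)$.
   Context: An ordered matroid $(M,<)$ is a matroid on a ground set $E$ together with a total order $<$ on $E$. A broken circuit is a set $C\setminus\{\min C\}$ for a circuit $C$ of $M$. A basis is an nbc basis if it contains no broken circuit. For a basis $B$, an element $b\in B$ is internally passive if there exists $b'<b$ with $(B\setminus\{b\})\cup\{b'\}$ a basis; $IP(B)$ denotes the set of internally passive elements of $B$. $\mathrm{Int}_<(M)$ is the poset on the set of bases of $M$ in which $B\le B'$ if and only if $IP(B)\subseteq IP(B')$. -}

module Defs where

open import Data.Nat using (ℕ; _<_)
open import Data.Fin using (Fin)
open import Data.Fin.Subset using (Subset; _∈_; _∉_; _⊆_; _⊂_; _∪_; _-_; ⁅_⁆; ∣_∣; ⊥)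
open import Data.Product using (_×_; Σ; ∃; _,_)
open import Relation.Nullary using (¬_)
open import Relation.Binary.PropositionalEquality using (_≡_; _≢_)
open import Level using (0ℓ; suc)

record Matroid (n : ℕ) : Set₁ where
  field
    Indep     : Subset n → Set
    indep-⊥   : Indep ⊥
    indep-⊆   : ∀ {X Y} → X ⊆ Y → Indep Y → Indep X
    indep-aug : ∀ {X Y} → Indep X → Indep Y → ∣ X ∣ < ∣ Y ∣ →
                ∃ λ y → y ∈ Y × y ∉ X × Indep (X ∪ ⁅ y ⁆)

module _ {n : ℕ} (M : Matroid n) where
  open Matroid M

  IsBasis : Subset n → Set
  IsBasis B = Indep B × (∀ X → B ⊆ X → Indep X → X ⊆ B)

  IsCircuit : Subset n → Set
  IsCircuit C = ¬ Indep C × (∀ X → X ⊂ C → Indep X)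

  Loopless : Set
  Loopless = ∀ e → Indep ⁅ e ⁆

  module _ (_≺_ : Fin n → Fin n → Set) where

    IsMinOf : Fin n → Subset n → Set
    IsMinOf e C = e ∈ C × (∀ x → x ∈ C → x ≢ e → e ≺ x)

    IsBrokenCircuit : Subset n → Set
    IsBrokenCircuit D = Σ (Subset n) λ C → Σ (Fin n) λ e →
      IsCircuit C × IsMinOf e C × D ≡ C - e

    IsNBCBasis : Subset n → Set
    IsNBCBasis B = IsBasis B × (∀ D → IsBrokenCircuit D → ¬ (D ⊆ B))

    InternallyPassive : Subset n → Fin n → Set
    InternallyPassive B b = b ∈ B × (Σ (Fin n) λ b' → b' ≺ b × IsBasis ((B - b) ∪ ⁅ b' ⁆))

    _≤Int_ : Subset n → Subset n → Set
    B ≤Int B' = ∀ b → InternallyPassive B b → InternallyPassive B' b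

module Submission where

-- Let B ≤ B' in Int_<(M) with B' an nbc basis, and suppose
-- some broken circuit D = C - e (e the ≺-minimum of the circuit C) lies
-- inside B.  For every x ∈ D the basis-exchange property of circuits shows
-- that (B - x) ∪ {e} is again a basis, and e ≺ x; hence every element of D
-- is internally passive in B.  Since IP(B) ⊆ IP(B') ⊆ B', the broken
-- circuit D lies inside B', contradicting that B' is nbc.

open import Defs
open import Data.Nat using (ℕ; zero; suc; _≤_; _+_; z≤n; s≤s; _≤?_)
open import Data.Nat.Properties
  using (≤-trans; ≤-reflexive; +-comm; module ≤-Reasoning; +-suc; +-monoʳ-≤; n≤1+n; <⇒≱; ≰⇒>; m≤m+n)
open import Data.Fin using (Fin; _≟_)
open import Data.Fin.Subset
  using (Subset; _∈_; _∉_; _⊆_; _∪_; _─_; _-_; ⁅_⁆; ∣_∣; inside; outside)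
open import Data.Fin.Subset.Properties
  using ( _∈?_; x∈⁅x⁆; x∈⁅y⁆⇒x≡y; ∣⁅x⁆∣≡1; p⊆q⇒∣p∣≤∣q∣; p⊂q⇒∣p∣<∣q∣; x∈p∪q⁻; x∈p∪q⁺
        ; p⊆p∪q; p─q⊆p; x∈p∧x≢y⇒x∈p-y; x∈p⇒p-x⊂p; x∈p⇒∣p-x∣<∣p∣)
open import Data.Vec using ([]; _∷_)
open import Data.Vec.Base using (there)
open import Data.Product using (_×_; ∃; _,_; proj₁; proj₂)
open import Data.Sum using (inj₁; inj₂)
open import Relation.Nullary using (¬_; yes; no; contradiction)
open import Relation.Binary.PropositionalEquality using (_≡_; refl; sym; cong; _≢_)
open import Relation.Binary.Structures using (IsStrictTotalOrder)

∈─⇒∉ : ∀ {n} {x : Fin n} (p q : Subset n) → x ∈ p ─ q → x ∉ q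
∈─⇒∉ (_ ∷ p) (inside  ∷ q) (there x∈p─q) (there x∈q) = ∈─⇒∉ p q x∈p─q x∈q
∈─⇒∉ (_ ∷ p) (outside ∷ q) (there x∈p─q) (there x∈q) = ∈─⇒∉ p q x∈p─q x∈q

∈-⇒≢ : ∀ {n} {x y : Fin n} (p : Subset n) → x ∈ p - y → x ≢ y
∈-⇒≢ {y = y} p x∈p-y refl = ∈─⇒∉ p ⁅ y ⁆ x∈p-y (x∈⁅x⁆ y)

-⊆⇒⊆ : ∀ {n} {p S : Subset n} (y : Fin n) → p - y ⊆ S → y ∈ S → p ⊆ S
-⊆⇒⊆ {p = p} y p-y⊆S y∈S {x} x∈p with x ≟ y
... | yes refl = y∈S
... | no x≢y   = p-y⊆S (x∈p∧x≢y⇒x∈p-y x∈p x≢y)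

∣p∪q∣≤∣p∣+∣q∣ : ∀ {n} (p q : Subset n) → ∣ p ∪ q ∣ ≤ ∣ p ∣ + ∣ q ∣
∣p∪q∣≤∣p∣+∣q∣ []            []            = z≤n
∣p∪q∣≤∣p∣+∣q∣ (inside  ∷ p) (inside  ∷ q) =
  s≤s (≤-trans (∣p∪q∣≤∣p∣+∣q∣ p q) (+-monoʳ-≤ ∣ p ∣ (n≤1+n ∣ q ∣)))
∣p∪q∣≤∣p∣+∣q∣ (inside  ∷ p) (outside ∷ q) = s≤s (∣p∪q∣≤∣p∣+∣q∣ p q)
∣p∪q∣≤∣p∣+∣q∣ (outside ∷ p) (inside  ∷ q) =
  ≤-trans (s≤s (∣p∪q∣≤∣p∣+∣q∣ p q)) (≤-reflexive (sym (+-suc ∣ p ∣ ∣ q ∣)))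
∣p∪q∣≤∣p∣+∣q∣ (outside ∷ p) (outside ∷ q) = ∣p∪q∣≤∣p∣+∣q∣ p q

∣p∪⁅y⁆∣≤1+∣p∣ : ∀ {n} (p : Subset n) (y : Fin n) → ∣ p ∪ ⁅ y ⁆ ∣ ≤ suc ∣ p ∣
∣p∪⁅y⁆∣≤1+∣p∣ p y = begin
  ∣ p ∪ ⁅ y ⁆ ∣        ≤⟨ ∣p∪q∣≤∣p∣+∣q∣ p ⁅ y ⁆ ⟩
  ∣ p ∣ + ∣ ⁅ y ⁆ ∣    ≡⟨ cong (∣ p ∣ +_) (∣⁅x⁆∣≡1 y) ⟩
  ∣ p ∣ + 1            ≡⟨ +-comm ∣ p ∣ 1 ⟩
  suc ∣ p ∣            ∎
  where open ≤-Reasoning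

⊆∧∣≥∣⇒⊇ : ∀ {n} {p q : Subset n} → p ⊆ q → ∣ q ∣ ≤ ∣ p ∣ → q ⊆ p
⊆∧∣≥∣⇒⊇ {p = p} p⊆q ∣q∣≤∣p∣ {x} x∈q with x ∈? p
... | yes x∈p = x∈p
... | no  x∉p = contradiction ∣q∣≤∣p∣ (<⇒≱ (p⊂q⇒∣p∣<∣q∣ (p⊆q , x , x∈q , x∉p)))

module MatroidFacts {n : ℕ} (M : Matroid n) where
  open Matroid M

  -- The argument iterates augmentation; k bounds the number of steps.
  extend-within : (Z : Subset n) {I B : Subset n} → Indep I → I ⊆ Z → Indep B → B ⊆ Z →
                  ∃ λ J → Indep J × I ⊆ J × J ⊆ Z × ∣ B ∣ ≤ ∣ J ∣
  extend-within Z {I} {B} indI I⊆Z indB B⊆Z = go ∣ B ∣ I indI I⊆Z (m≤m+n ∣ B ∣ ∣ I ∣)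
    where
    go : (k : ℕ) (I : Subset n) → Indep I → I ⊆ Z → ∣ B ∣ ≤ k + ∣ I ∣ →
         ∃ λ J → Indep J × I ⊆ J × J ⊆ Z × ∣ B ∣ ≤ ∣ J ∣
    go k I indI I⊆Z bound with ∣ B ∣ ≤? ∣ I ∣
    ... | yes ∣B∣≤∣I∣ = I , indI , (λ x∈I → x∈I) , I⊆Z , ∣B∣≤∣I∣
    go zero I indI I⊆Z bound | no ∣B∣≰∣I∣ = contradiction bound ∣B∣≰∣I∣
    go (suc k) I indI I⊆Z bound | no ∣B∣≰∣I∣
      with indep-aug indI indB (≰⇒> ∣B∣≰∣I∣)
    ... | y , y∈B , y∉I , indIy
      with go k (I ∪ ⁅ y ⁆) indIy Iy⊆Z bound′
      where
      Iy⊆Z : I ∪ ⁅ y ⁆ ⊆ Z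
      Iy⊆Z x∈Iy with x∈p∪q⁻ I ⁅ y ⁆ x∈Iy
      ... | inj₁ x∈I = I⊆Z x∈I
      ... | inj₂ x∈y rewrite x∈⁅y⁆⇒x≡y y x∈y = B⊆Z y∈B
      grows : suc ∣ I ∣ ≤ ∣ I ∪ ⁅ y ⁆ ∣
      grows = p⊂q⇒∣p∣<∣q∣ (p⊆p∪q ⁅ y ⁆ , y , x∈p∪q⁺ (inj₂ (x∈⁅x⁆ y)) , y∉I)
      bound′ : ∣ B ∣ ≤ k + ∣ I ∪ ⁅ y ⁆ ∣
      bound′ = begin
        ∣ B ∣                ≤⟨ bound ⟩
        suc (k + ∣ I ∣)      ≡⟨ sym (+-suc k ∣ I ∣) ⟩
        k + suc ∣ I ∣        ≤⟨ +-monoʳ-≤ k grows ⟩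
        k + ∣ I ∪ ⁅ y ⁆ ∣    ∎
        where open ≤-Reasoning
    ... | J , indJ , Iy⊆J , J⊆Z , ∣B∣≤∣J∣ =
      J , indJ , (λ x∈I → Iy⊆J (p⊆p∪q ⁅ y ⁆ x∈I)) , J⊆Z , ∣B∣≤∣J∣

  indep-≤-basis : {B Y : Subset n} → IsBasis M B → Indep Y → ∣ Y ∣ ≤ ∣ B ∣
  indep-≤-basis {B} {Y} (indB , maxB) indY with ∣ Y ∣ ≤? ∣ B ∣
  ... | yes ∣Y∣≤∣B∣ = ∣Y∣≤∣B∣
  ... | no  ∣Y∣≰∣B∣ with indep-aug indB indY (≰⇒> ∣Y∣≰∣B∣)
  ... | y , _ , y∉B , indBy =
    contradiction (maxB (B ∪ ⁅ y ⁆) (p⊆p∪q ⁅ y ⁆) indBy (x∈p∪q⁺ (inj₂ (x∈⁅x⁆ y)))) y∉B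

  large-indep-is-basis : {B X : Subset n} → IsBasis M B → Indep X → ∣ B ∣ ≤ ∣ X ∣ → IsBasis M X
  large-indep-is-basis basisB indX ∣B∣≤∣X∣ =
    indX , λ Y X⊆Y indY → ⊆∧∣≥∣⇒⊇ X⊆Y (≤-trans (indep-≤-basis basisB indY) ∣B∣≤∣X∣)

  circuit-⊈-indep : {C I : Subset n} → IsCircuit M C → C ⊆ I → ¬ Indep I
  circuit-⊈-indep (depC , _) C⊆I indI = depC (indep-⊆ C⊆I indI)

  -- Extend C - b to
  -- an independent J ⊆ B ∪ {e} as large as B; J avoids b (else C ⊆ J), so
  -- J ⊆ (B - b) ∪ {e}, and comparing sizes the two sets coincide.
  circuit-exchange : {B C : Subset n} {e b : Fin n} → IsBasis M B → IsCircuit M C →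
                     C - e ⊆ B → b ∈ C → b ≢ e → IsBasis M ((B - b) ∪ ⁅ e ⁆)
  circuit-exchange {B} {C} {e} {b} basisB circC C-e⊆B b∈C b≢e
    with extend-within (B ∪ ⁅ e ⁆) (proj₂ circC (C - b) (x∈p⇒p-x⊂p b∈C))
                       C-b⊆B∪e (proj₁ basisB) (p⊆p∪q ⁅ e ⁆)
    where
    C-b⊆B∪e : C - b ⊆ B ∪ ⁅ e ⁆
    C-b⊆B∪e {x} x∈C-b with x ≟ e
    ... | yes refl = x∈p∪q⁺ (inj₂ (x∈⁅x⁆ e))
    ... | no  x≢e  = x∈p∪q⁺ (inj₁ (C-e⊆B (x∈p∧x≢y⇒x∈p-y (p─q⊆p C ⁅ b ⁆ x∈C-b) x≢e)))
  ... | J , indJ , C-b⊆J , J⊆B∪e , ∣B∣≤∣J∣ =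
    large-indep-is-basis basisB indX (≤-trans ∣B∣≤∣J∣ (p⊆q⇒∣p∣≤∣q∣ J⊆X))
    where
    X : Subset n
    X = (B - b) ∪ ⁅ e ⁆

    J⊆X : J ⊆ X
    J⊆X {x} x∈J with x ≟ b | x∈p∪q⁻ B ⁅ e ⁆ (J⊆B∪e x∈J)
    ... | yes refl | _        = contradiction indJ (circuit-⊈-indep circC (-⊆⇒⊆ b C-b⊆J x∈J))
    ... | no  x≢b  | inj₁ x∈B = x∈p∪q⁺ (inj₁ (x∈p∧x≢y⇒x∈p-y x∈B x≢b))
    ... | no  _    | inj₂ x∈e = x∈p∪q⁺ (inj₂ x∈e)

    ∣X∣≤∣B∣ : ∣ X ∣ ≤ ∣ B ∣
    ∣X∣≤∣B∣ = ≤-trans (∣p∪⁅y⁆∣≤1+∣p∣ (B - b) e)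
                      (x∈p⇒∣p-x∣<∣p∣ (C-e⊆B (x∈p∧x≢y⇒x∈p-y b∈C b≢e)))

    indX : Indep X
    indX = indep-⊆ (⊆∧∣≥∣⇒⊇ J⊆X (≤-trans ∣X∣≤∣B∣ ∣B∣≤∣J∣)) indJ

  module _ (_≺_ : Fin n → Fin n → Set) where

    broken-circuit-⊆-passive : {B D : Subset n} → IsBasis M B → IsBrokenCircuit M _≺_ D →
                               D ⊆ B → ∀ x → x ∈ D → InternallyPassive M _≺_ B x
    broken-circuit-⊆-passive basisB (C , e , circC , (_ , e-min) , refl) C-e⊆B x x∈C-e =
      C-e⊆B x∈C-e , e , e-min x x∈C x≢e , circuit-exchange basisB circC C-e⊆B x∈C x≢e
      where
      x∈C : x ∈ C
      x∈C = p─q⊆p C ⁅ e ⁆ x∈C-e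
      x≢e : x ≢ e
      x≢e = ∈-⇒≢ C x∈C-e

open MatroidFacts using (broken-circuit-⊆-passive)

-- A broken
-- circuit inside B consists of internally passive elements of B, hence of
-- B' as well, so it would lie inside the nbc basis B'.
theorem4p1 : {n : ℕ} (M : Matroid n) (_≺_ : Fin n → Fin n → Set) →
    IsStrictTotalOrder _≡_ _≺_ → Loopless M →
    (B B' : Subset n) → IsBasis M B → IsBasis M B' →
    _≤Int_ M _≺_ B B' → IsNBCBasis M _≺_ B' → IsNBCBasis M _≺_ B
theorem4p1 M _≺_ _ _ B B' basisB _ B≤B' (_ , nbcB') = basisB , nbcB
  where
  nbcB : ∀ D → IsBrokenCircuit M _≺_ D → ¬ (D ⊆ B)
  nbcB D brokenD D⊆B = nbcB' D brokenD D⊆B'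
    where
    D⊆B' : D ⊆ B'
    D⊆B' {x} x∈D = proj₁ (B≤B' x (broken-circuit-⊆-passive M _≺_ basisB brokenD D⊆B x x∈D))
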